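{- Let $n\ge 0$ and let $u\in[2]^n$, i.e. $u$ is a word of length $n$ whose letters all lie in $\{1,2\}$. Then $u$ is strongly stable: $C(u^k)=C(u)$ for every integer $k\ge 1$.
   Context: Words are finite sequences of positive integers; juxtaposition denotes concatenation, and $u^k$ denotes $u$ concatenated with itself $k$ times. For a word $w$, $P(w)$ is its insertion tableau under the Robinson–Schensted–Knuth (row-insertion) correspondence. The centralizer of a word $u$ in the plactic monoid is $C(u)=\{w \text{ a word over the positive integers} : P(uw)=P(wu)\}$. A word $u$ is called strongly stable if $C(u^k)=C(u)$ for all $k\ge1$. -}

module Defs where

open import Data.Nat using (ℕ; zero; suc; _≤_; _<ᵇ_)
open import Data.Bool using (if_then_else_)
open import Data.List using (List; []; _∷_; _++_; foldl)
open import Data.List.Relation.Unary.All using (All)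
open import Data.Product using (_×_; _,_)
open import Data.Maybe using (Maybe; just; nothing)
open import Relation.Binary.PropositionalEquality using (_≡_)

Word : Set
Word = List ℕ

PositiveWord : Word → Set
PositiveWord w = All (λ x → 1 ≤ x) w

-- A (semistandard) tableau is represented as its list of rows, top row first.
Tableau : Set
Tableau = List (List ℕ)

rowInsert : ℕ → List ℕ → List ℕ × Maybe ℕ
rowInsert x [] = (x ∷ [] , nothing)
rowInsert x (y ∷ ys) with x <ᵇ y
... | Data.Bool.true  = (x ∷ ys , just y)
... | Data.Bool.false with rowInsert x ys
...   | (ys' , b) = (y ∷ ys' , b)

insertT : ℕ → Tableau → Tableau
insertT x [] = (x ∷ []) ∷ []
insertT x (r ∷ rs) with rowInsert x r
... | (r' , nothing) = r' ∷ rs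
... | (r' , just y)  = r' ∷ insertT y rs

P : Word → Tableau
P w = foldl (λ T x → insertT x T) [] w

_^ʷ_ : Word → ℕ → Word
u ^ʷ zero = []
u ^ʷ suc k = u ++ (u ^ʷ k)

C : Word → Word → Set
C u w = PositiveWord w × (P (u ++ w) ≡ P (w ++ u))

{-# OPTIONS --safe #-}
module Submission where

-- For a letter a ∈ {1, 2}, P (a w) is a function of P w: 1 is prepended to the first row, and 2 is put in
-- front of the second row, after which the empty corner above it is slid out by jeu de taquin, which commutes
-- with row insertion. Hence P (u w) = P (w u) gives P (u^k w) = P (w u^k) for u over {1, 2}.
--
-- Conversely, weigh a tableau by the sum of the row indices of its letters ≥ 3. Left factors from {1, 2} can
-- only lift such letters and right factors can only push them down, changing the weight unless nothing
-- moves. Along P (u^(k+1) w), P (u w), P (w), P (w u), P (w u^(k+1)) the ends agree, so P (u w) and P (w u)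
-- have the same letters ≥ 3 in each row. Their letters 1 and 2 form the insertion tableaux of the
-- {1, 2}-subwords, which live in the plactic monoid of rank 2, where an element and its powers have the
-- same centraliser. The two parts together determine a tableau.

open import Defs
open import Data.Bool using (true; false; T)
open import Data.Empty using (⊥; ⊥-elim)
open import Data.List using (List; []; _∷_; _++_; foldl; foldr; length; replicate; filter; head; drop; fromMaybe)
open import Data.List.Properties
  using (foldl-++; ++-assoc; ++-identityʳ; filter-accept; filter-reject; filter-all; filter-none; filter-++; length-++)
open import Data.List.Relation.Binary.Permutation.Propositional using (_↭_; ↭-refl; ↭-prep; ↭-swap; ↭-trans)
open import Data.List.Relation.Binary.Permutation.Propositional.Properties using (++-comm; ↭-length; filter-↭)
open import Data.List.Relation.Unary.All as All using (All; []; _∷_)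
open import Data.List.Relation.Unary.All.Properties using (++⁺)
open import Data.List.Relation.Unary.AllPairs as AllPairs using (AllPairs; []; _∷_)
open import Data.Maybe using (Maybe; just; nothing)
open import Data.Maybe.Properties using (just-injective)
import Data.Maybe.Relation.Unary.All as Maybe
open import Data.Maybe.Relation.Unary.Any using (Any; just)
open import Data.Nat
open import Data.Nat.Properties
open import Algebra.Properties.CommutativeSemigroup +-commutativeSemigroup using (x∙yz≈y∙xz)
open import Data.Nat.Tactic.RingSolver using (solve-∀)
open import Data.Product using (_×_; _,_; proj₁; proj₂; ∃₂)
open import Data.Sum using (_⊎_; inj₁; inj₂)
open import Data.Unit using (tt; ⊤)
open import Function.Base using (_∘_; case_of_)
open import Function.Bundles using (_⇔_; mk⇔)
open import Relation.Binary.PropositionalEquality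
open import Relation.Nullary using (yes; no)
open import Relation.Unary using (Decidable)

rowInsert-bump : ∀ {x y} ys → x < y → rowInsert x (y ∷ ys) ≡ (x ∷ ys , just y)
rowInsert-bump {x} {y} ys x<y with x <ᵇ y in eq
... | true  = refl
... | false = ⊥-elim (subst T eq (<⇒<ᵇ x<y))

rowInsert-skip : ∀ {x y} ys → y ≤ x →
                 rowInsert x (y ∷ ys) ≡ (y ∷ proj₁ (rowInsert x ys) , proj₂ (rowInsert x ys))
rowInsert-skip {x} {y} ys y≤x with x <ᵇ y in eq
... | true  = ⊥-elim (<⇒≱ (<ᵇ⇒< x y (subst T (sym eq) tt)) y≤x)
... | false with rowInsert x ys
...   | _ = refl

rowInsert-<-head : ∀ x r → Maybe.All (x <_) (head r) → rowInsert x r ≡ (x ∷ drop 1 r , head r)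
rowInsert-<-head x []      _               = refl
rowInsert-<-head x (y ∷ r) (Maybe.just x<y) = rowInsert-bump r x<y

insertMaybe : Maybe ℕ → Tableau → Tableau
insertMaybe nothing  rs = rs
insertMaybe (just y) rs = insertT y rs

insertT-∷ : ∀ x r rs → insertT x (r ∷ rs) ≡ proj₁ (rowInsert x r) ∷ insertMaybe (proj₂ (rowInsert x r)) rs
insertT-∷ x r rs with rowInsert x r
... | (_ , nothing) = refl
... | (_ , just _)  = refl

insertWord : Tableau → Word → Tableau
insertWord = foldl (λ T x → insertT x T)

P-++ : ∀ u v → P (u ++ v) ≡ insertWord (P u) v
P-++ = foldl-++ (λ T x → insertT x T) []

Sorted : List ℕ → Set
Sorted = AllPairs _≤_

Sorted⇒All≤ : ∀ {x xs} → Sorted (x ∷ xs) → All (x ≤_) (x ∷ xs)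
Sorted⇒All≤ (x≤xs ∷ _) = ≤-refl ∷ x≤xs

rowInsert-All : ∀ {Q : ℕ → Set} x r → All Q r → Q x → All Q (proj₁ (rowInsert x r))
rowInsert-All x []       []         qx = qx ∷ []
rowInsert-All x (y ∷ ys) (qy ∷ qys) qx with x <? y
... | yes x<y rewrite rowInsert-bump ys x<y = qx ∷ qys
... | no  x≮y rewrite rowInsert-skip ys (≮⇒≥ x≮y) = qy ∷ rowInsert-All x ys qys qx

bumped-All : ∀ {Q : ℕ → Set} x r → All Q r → Maybe.All Q (proj₂ (rowInsert x r))
bumped-All x []       []         = Maybe.nothing
bumped-All x (y ∷ ys) (qy ∷ qys) with x <? y
... | yes x<y rewrite rowInsert-bump ys x<y = Maybe.just qy
... | no  x≮y rewrite rowInsert-skip ys (≮⇒≥ x≮y) = bumped-All x ys qys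

bumped-> : ∀ x r → Maybe.All (x <_) (proj₂ (rowInsert x r))
bumped-> x []       = Maybe.nothing
bumped-> x (y ∷ ys) with x <? y
... | yes x<y rewrite rowInsert-bump ys x<y = Maybe.just x<y
... | no  x≮y rewrite rowInsert-skip ys (≮⇒≥ x≮y) = bumped-> x ys

bumped-leftmost : ∀ x r → Sorted r →
                  Maybe.All (λ y → All (λ e → x < e → y ≤ e) r) (proj₂ (rowInsert x r))
bumped-leftmost x []       []           = Maybe.nothing
bumped-leftmost x (y ∷ ys) (y≤ys ∷ sys) with x <? y
... | yes x<y rewrite rowInsert-bump ys x<y = Maybe.just ((λ _ → ≤-refl) ∷ All.map (λ y≤e _ → y≤e) y≤ys)
... | no  x≮y rewrite rowInsert-skip ys (≮⇒≥ x≮y) =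
  Maybe.map (λ h → (λ x<y → ⊥-elim (x≮y x<y)) ∷ h) (bumped-leftmost x ys sys)

bumped-head : ∀ x r → Maybe.All (λ _ → Any (_≤ x) (head (proj₁ (rowInsert x r)))) (proj₂ (rowInsert x r))
bumped-head x []       = Maybe.nothing
bumped-head x (y ∷ ys) with x <? y
... | yes x<y rewrite rowInsert-bump ys x<y = Maybe.just (just ≤-refl)
... | no  x≮y rewrite rowInsert-skip ys (≮⇒≥ x≮y) = Maybe.map (λ _ → just (≮⇒≥ x≮y)) (bumped-head x ys)

unbumped⇒All≤ : ∀ x r → proj₂ (rowInsert x r) ≡ nothing → All (_≤ x) r
unbumped⇒All≤ x []       _  = []
unbumped⇒All≤ x (y ∷ ys) eq with x <? y
... | yes x<y rewrite rowInsert-bump ys x<y with () ← eq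
... | no  x≮y rewrite rowInsert-skip ys (≮⇒≥ x≮y) = ≮⇒≥ x≮y ∷ unbumped⇒All≤ x ys eq

rowInsert-sorted : ∀ x r → Sorted r → Sorted (proj₁ (rowInsert x r))
rowInsert-sorted x []       []             = [] ∷ []
rowInsert-sorted x (y ∷ ys) (y≤ys ∷ s) with x <? y
... | yes x<y rewrite rowInsert-bump ys x<y = All.map (≤-trans (<⇒≤ x<y)) y≤ys ∷ s
... | no  x≮y rewrite rowInsert-skip ys (≮⇒≥ x≮y) =
  rowInsert-All x ys y≤ys (≮⇒≥ x≮y) ∷ rowInsert-sorted x ys s

rowInsertMaybe : Maybe ℕ → List ℕ → List ℕ × Maybe ℕ
rowInsertMaybe nothing  r = (r , nothing)
rowInsertMaybe (just y) r = rowInsert y r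

rowInsertMaybe-skip : ∀ {c} m r → Maybe.All (c ≤_) m →
                      rowInsertMaybe m (c ∷ r) ≡ (c ∷ proj₁ (rowInsertMaybe m r) , proj₂ (rowInsertMaybe m r))
rowInsertMaybe-skip nothing  r _                = refl
rowInsertMaybe-skip (just y) r (Maybe.just c≤y) = rowInsert-skip r c≤y

rowInsert-↭ : ∀ x r → proj₁ (rowInsert x r) ++ fromMaybe (proj₂ (rowInsert x r)) ↭ x ∷ r
rowInsert-↭ x []       = ↭-refl
rowInsert-↭ x (y ∷ ys) with x <? y
... | yes x<y rewrite rowInsert-bump ys x<y = ↭-prep x (++-comm ys (y ∷ []))
... | no  x≮y rewrite rowInsert-skip ys (≮⇒≥ x≮y) = ↭-trans (↭-prep y (rowInsert-↭ x ys)) (↭-swap y x ↭-refl)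

count : {Q : ℕ → Set} → Decidable Q → List ℕ → ℕ
count Q? r = length (filter Q? r)

count-++ : ∀ {Q : ℕ → Set} (Q? : Decidable Q) xs ys → count Q? (xs ++ ys) ≡ count Q? xs + count Q? ys
count-++ Q? xs ys = trans (cong length (filter-++ Q? xs ys)) (length-++ (filter Q? xs))

rowInsert-count : ∀ {Q : ℕ → Set} (Q? : Decidable Q) x r →
  count Q? (proj₁ (rowInsert x r)) + count Q? (fromMaybe (proj₂ (rowInsert x r))) ≡ count Q? (x ∷ r)
rowInsert-count Q? x r =
  trans (sym (count-++ Q? (proj₁ (rowInsert x r)) _)) (↭-length (filter-↭ Q? (rowInsert-↭ x r)))

-- Sliding the hole out of a two-row skew tableau

ColumnStrict : List ℕ → List ℕ → Set
ColumnStrict r       []      = ⊤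
ColumnStrict []      (_ ∷ _) = ⊥
ColumnStrict (t ∷ r) (b ∷ B) = t < b × ColumnStrict r B

-- Jeu de taquin on the skew rows (∙ ∷ r) over B, column strict when ColumnStrict r (drop 1 B):
-- the empty cell ∙ moves right or down until it leaves.
slide : List ℕ → List ℕ → List ℕ × List ℕ
slide r       []      = (r , [])
slide []      (c ∷ B) = (c ∷ [] , B)
slide (t ∷ r) (c ∷ B) with c ≤? t
... | yes _ = (c ∷ t ∷ r , B)
... | no  _ = (t ∷ proj₁ (slide r B) , c ∷ proj₂ (slide r B))

slide-up : ∀ {t c} r B → c ≤ t → slide (t ∷ r) (c ∷ B) ≡ (c ∷ t ∷ r , B)
slide-up {t} {c} r B c≤t with c ≤? t
... | yes _   = refl
... | no  c≰t = ⊥-elim (c≰t c≤t)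

slide-left : ∀ {t c} r B → t < c → slide (t ∷ r) (c ∷ B) ≡ (t ∷ proj₁ (slide r B) , c ∷ proj₂ (slide r B))
slide-left {t} {c} r B t<c with c ≤? t
... | yes c≤t = ⊥-elim (<⇒≱ t<c c≤t)
... | no  _   = refl

slide-front : ∀ {c} r B → All (c ≤_) r → slide r (c ∷ B) ≡ (c ∷ r , B)
slide-front []      B _           = refl
slide-front (t ∷ r) B (c≤t ∷ _) = slide-up r B c≤t

slide-All : ∀ {Q : ℕ → Set} r B → All Q r → All Q B → All Q (proj₁ (slide r B))
slide-All r       []      qr         _          = qr
slide-All []      (c ∷ B) []         (qc ∷ _)   = qc ∷ []
slide-All (t ∷ r) (c ∷ B) (qt ∷ qr) (qc ∷ qB) with c ≤? t
... | yes _ = qc ∷ qt ∷ qr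
... | no  _ = qt ∷ slide-All r B qr qB

carry : List ℕ × Maybe ℕ → List ℕ → List ℕ × List ℕ × Maybe ℕ
carry (r₁ , m) r₂ = r₁ , rowInsertMaybe m r₂

insert₂ : ℕ → List ℕ → List ℕ → List ℕ × List ℕ × Maybe ℕ
insert₂ x r₁ = carry (rowInsert x r₁)

slide₂ : List ℕ × List ℕ × Maybe ℕ → List ℕ × List ℕ × Maybe ℕ
slide₂ (r₁ , r₂ , m) = proj₁ (slide r₁ r₂) , proj₂ (slide r₁ r₂) , m

slide₂-insert₂-[] : ∀ x r → slide₂ (insert₂ x r []) ≡ insert₂ x r []
slide₂-insert₂-[] x r = by-bumped (rowInsert x r) (bumped-head x r) (bumped-> x r)
  where
  by-bumped : ∀ p → Maybe.All (λ _ → Any (_≤ x) (head (proj₁ p))) (proj₂ p) → Maybe.All (x <_) (proj₂ p) →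
           slide₂ (carry p []) ≡ carry p []
  by-bumped (_ , nothing) _ _ = refl
  by-bumped (h ∷ a , just y) (Maybe.just (just h≤x)) (Maybe.just x<y)
    rewrite slide-left a [] (≤-<-trans h≤x x<y) = refl

ColumnStrict-head : ∀ {t} r B → ColumnStrict (t ∷ r) B → Maybe.All (t <_) (head B)
ColumnStrict-head r []      _         = Maybe.nothing
ColumnStrict-head r (b ∷ B) (t<b , _) = Maybe.just t<b

ColumnStrict-tail : ∀ {t} r B → ColumnStrict (t ∷ r) B → ColumnStrict r (drop 1 B)
ColumnStrict-tail r []      _        = tt
ColumnStrict-tail r (b ∷ B) (_ , cs) = cs

slide-bumped : ∀ x r B y → Sorted r → proj₂ (rowInsert x r) ≡ just y → All (y <_) B →
  rowInsert x (proj₁ (slide r B)) ≡ (proj₁ (slide (proj₁ (rowInsert x r)) B) , just y) ×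
  proj₂ (slide (proj₁ (rowInsert x r)) B) ≡ proj₂ (slide r B)
slide-bumped x r       []      y _ eq _ = cong (proj₁ (rowInsert x r) ,_) eq , refl
slide-bumped x []      (b ∷ B) y _ () _
slide-bumped x (t ∷ s) (b ∷ B) y st eq (y<b ∷ y<B) with b ≤? t
... | yes b≤t = ⊥-elim (<⇒≱ y<b (≤-trans b≤t t≤y))
  where
  t≤y : t ≤ y
  t≤y = Maybe.drop-just (subst (Maybe.All (t ≤_)) eq (bumped-All x (t ∷ s) (Sorted⇒All≤ st)))
... | no b≰t with x <? t
...   | yes x<t rewrite rowInsert-bump s x<t | just-injective eq
                      | rowInsert-bump (proj₁ (slide s B)) x<t | slide-left s B (<-trans x<t (≰⇒> b≰t)) =
  refl , refl
...   | no x≮t rewrite rowInsert-skip s (≮⇒≥ x≮t) | rowInsert-skip (proj₁ (slide s B)) (≮⇒≥ x≮t)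
                     | slide-left (proj₁ (rowInsert x s)) B (≰⇒> b≰t)
  with ih₁ , ih₂ ← slide-bumped x s B y (AllPairs.tail st) eq y<B =
  cong (λ (r , m) → t ∷ r , m) ih₁ , cong (b ∷_) ih₂

bumped-≥⇒≤⊎≥ : ∀ {c} x r → Sorted r → Maybe.All (c ≤_) (proj₂ (rowInsert x r)) →
                 All (λ e → e ≤ x ⊎ c ≤ e) r
bumped-≥⇒≤⊎≥ {c} x r sr c≤m with proj₂ (rowInsert x r) in eq
... | nothing = All.map inj₁ (unbumped⇒All≤ x r eq)
... | just y  = All.map split (Maybe.drop-just (subst (Maybe.All _) eq (bumped-leftmost x r sr)))
  where
  split : ∀ {e} → (x < e → y ≤ e) → e ≤ x ⊎ c ≤ e
  split {e} y≤ with e ≤? x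
  ... | yes e≤x = inj₁ e≤x
  ... | no  e≰x = inj₂ (≤-trans (Maybe.drop-just c≤m) (y≤ (≰⇒> e≰x)))

bumped-≥-slide : ∀ {c} x r B → Sorted r → All (c ≤_) B → Maybe.All (c ≤_) (proj₂ (rowInsert x r)) →
                 Maybe.All (c ≤_) (proj₂ (rowInsert x (proj₁ (slide r B))))
bumped-≥-slide {c} x r B sr c≤B c≤m =
  Maybe.zipWith (λ { (inj₁ e≤x , x<e) → ⊥-elim (<⇒≱ x<e e≤x) ; (inj₂ c≤e , _) → c≤e })
    (bumped-All x (proj₁ (slide r B)) (slide-All r B (bumped-≥⇒≤⊎≥ x r sr c≤m) (All.map inj₂ c≤B))
    , bumped-> x (proj₁ (slide r B)))

insert₂-slide-skip : ∀ {t c} B d (p q : List ℕ × Maybe ℕ) → t < c →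
  carry q d ≡ slide₂ (carry p B) → Maybe.All (c ≤_) (proj₂ p) → Maybe.All (c ≤_) (proj₂ q) →
  carry (t ∷ proj₁ q , proj₂ q) (c ∷ d) ≡ slide₂ (carry (t ∷ proj₁ p , proj₂ p) (c ∷ B))
insert₂-slide-skip {t} {c} B d (a , m) (a' , m') t<c ih c≤m c≤m'
  rewrite rowInsertMaybe-skip m B c≤m | rowInsertMaybe-skip m' d c≤m'
        | slide-left a (proj₁ (rowInsertMaybe m B)) t<c =
  cong (λ (r₁ , r₂ , m) → t ∷ r₁ , c ∷ r₂ , m) ih

-- The step of insert₂-slide where ∙ moves right past t ≤ x,
-- for p = rowInsert x r and q = rowInsert x (proj₁ (slide r B)).
insert₂-slide-left : ∀ {t c} B d (p q : List ℕ × Maybe ℕ) → t < c → Maybe.All (t <_) (proj₂ p) →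
  carry q d ≡ slide₂ (carry p B) →
  (∀ y → proj₂ p ≡ just y → y < c →
     q ≡ (proj₁ (slide (proj₁ p) B) , just y) × proj₂ (slide (proj₁ p) B) ≡ d) →
  (Maybe.All (c ≤_) (proj₂ p) → Maybe.All (c ≤_) (proj₂ q)) →
  carry (t ∷ proj₁ q , proj₂ q) (c ∷ d) ≡ slide₂ (carry (t ∷ proj₁ p , proj₂ p) (c ∷ B))
insert₂-slide-left B d p@(_ , nothing) q t<c _ ih _ c≤⇒c≤ =
  insert₂-slide-skip B d p q t<c ih Maybe.nothing (c≤⇒c≤ Maybe.nothing)
insert₂-slide-left {c = c} B d p@(a , just y) q t<c (Maybe.just t<y) ih moved c≤⇒c≤ with c ≤? y
... | yes c≤y = insert₂-slide-skip B d p q t<c ih (Maybe.just c≤y) (c≤⇒c≤ (Maybe.just c≤y))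
... | no  c≰y with refl , refl ← moved y refl (≰⇒> c≰y)
  rewrite rowInsert-bump B (≰⇒> c≰y) | rowInsert-bump (proj₂ (slide a B)) (≰⇒> c≰y) | slide-left a B t<y = refl

-- Row insertion commutes with jeu de taquin.
insert₂-slide : ∀ x r B → Sorted r → Sorted B → ColumnStrict r (drop 1 B) →
                insert₂ x (proj₁ (slide r B)) (proj₂ (slide r B)) ≡ slide₂ (insert₂ x r B)
insert₂-slide x r       []          _  _  _ = sym (slide₂-insert₂-[] x r)
insert₂-slide x []      (c ∷ [])    _  _  _ with x <? c
... | yes x<c rewrite rowInsert-bump [] x<c | slide-left [] [] x<c = refl
... | no  x≮c rewrite rowInsert-skip [] (≮⇒≥ x≮c) | slide-up [] [] (≮⇒≥ x≮c) = refl
insert₂-slide x (t ∷ r) (c ∷ B) sr (c≤B ∷ sB) cs with c ≤? t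
... | yes c≤t with x <? c
...   | yes x<c
  rewrite rowInsert-bump (t ∷ r) x<c | rowInsert-<-head c B (Maybe.map (≤-<-trans c≤t) (ColumnStrict-head r B cs))
        | rowInsert-bump r (<-≤-trans x<c c≤t) | rowInsert-skip B c≤t | rowInsert-<-head t B (ColumnStrict-head r B cs)
        | slide-left r (t ∷ drop 1 B) x<c | slide-front r (drop 1 B) (AllPairs.head sr) = refl
...   | no  x≮c
  rewrite rowInsert-skip (t ∷ r) (≮⇒≥ x≮c)
        | rowInsertMaybe-skip (proj₂ (rowInsert x (t ∷ r))) B
            (bumped-All x (t ∷ r) (All.map (≤-trans c≤t) (Sorted⇒All≤ sr)))
        | slide-front (proj₁ (rowInsert x (t ∷ r))) (proj₁ (rowInsertMaybe (proj₂ (rowInsert x (t ∷ r))) B))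
            (rowInsert-All x (t ∷ r) (All.map (≤-trans c≤t) (Sorted⇒All≤ sr)) (≮⇒≥ x≮c)) = refl
insert₂-slide x (t ∷ r) (c ∷ B) sr (c≤B ∷ sB) cs | no c≰t with x <? t
... | yes x<t
  rewrite rowInsert-bump (proj₁ (slide r B)) x<t | rowInsert-bump (proj₂ (slide r B)) (≰⇒> c≰t)
        | rowInsert-bump r x<t | rowInsert-bump B (≰⇒> c≰t) | slide-left r B x<t = refl
... | no  x≮t
  rewrite rowInsert-skip (proj₁ (slide r B)) (≮⇒≥ x≮t) | rowInsert-skip r (≮⇒≥ x≮t) =
  insert₂-slide-left B (proj₂ (slide r B)) (rowInsert x r) (rowInsert x (proj₁ (slide r B))) (≰⇒> c≰t)
    (Maybe.map (≤-<-trans (≮⇒≥ x≮t)) (bumped-> x r))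
    (insert₂-slide x r B (AllPairs.tail sr) sB (ColumnStrict-tail r B cs))
    (λ y eq y<c → slide-bumped x r B y (AllPairs.tail sr) eq (All.map (<-≤-trans y<c) c≤B))
    (bumped-≥-slide x r B (AllPairs.tail sr) c≤B)

-- Tableaux seen through their first two rows

row₁ : Tableau → List ℕ
row₁ []      = []
row₁ (r ∷ _) = r

row₂ : Tableau → List ℕ
row₂ (_ ∷ r ∷ _) = r
row₂ _           = []

rows₃ : Tableau → Tableau
rows₃ (_ ∷ _ ∷ rs) = rs
rows₃ _            = []

Rows : Set
Rows = List ℕ × List ℕ × Tableau

split : Tableau → Rows
split T = row₁ T , row₂ T , rows₃ T

-- Inverse to split on tableaux without empty rows.
build : List ℕ → List ℕ → Tableau → Tableau
build a (e ∷ d) rs       = a ∷ (e ∷ d) ∷ rs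
build a []      (r ∷ rs) = a ∷ [] ∷ r ∷ rs
build []      [] []      = []
build (h ∷ a) [] []      = (h ∷ a) ∷ []

split-build : ∀ a d rs → split (build a d rs) ≡ (a , d , rs)
split-build a       (e ∷ d) rs       = refl
split-build a       []      (r ∷ rs) = refl
split-build []      []      []       = refl
split-build (h ∷ a) []      []       = refl

assemble : List ℕ × List ℕ × Maybe ℕ → Tableau → Tableau
assemble (a , d , m) rs = build a d (insertMaybe m rs)

insertMaybe-∷ : ∀ m r rs →
                insertMaybe m (r ∷ rs) ≡ proj₁ (rowInsertMaybe m r) ∷ insertMaybe (proj₂ (rowInsertMaybe m r)) rs
insertMaybe-∷ nothing  r rs = refl
insertMaybe-∷ (just y) r rs = insertT-∷ y r rs

rowInsertMaybe-∷ : ∀ m e d → ∃₂ λ e′ d′ → proj₁ (rowInsertMaybe m (e ∷ d)) ≡ e′ ∷ d′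
rowInsertMaybe-∷ nothing  e d = e , d , refl
rowInsertMaybe-∷ (just y) e d with y <? e
... | yes y<e rewrite rowInsert-bump d y<e       = y , d , refl
... | no  y≮e rewrite rowInsert-skip d (≮⇒≥ y≮e) = e , _ , refl

insertT-build : ∀ x a d rs → insertT x (build a d rs) ≡ assemble (insert₂ x a d) rs
insertT-build x a (e ∷ d) rs
  rewrite insertT-∷ x a ((e ∷ d) ∷ rs) | insertMaybe-∷ (proj₂ (rowInsert x a)) (e ∷ d) rs
  with rowInsertMaybe-∷ (proj₂ (rowInsert x a)) e d
... | _ , _ , eq rewrite eq = refl
insertT-build x a [] (r ∷ rs)
  rewrite insertT-∷ x a ([] ∷ r ∷ rs) with proj₂ (rowInsert x a)
... | nothing = refl
... | just _  = refl
insertT-build x [] [] [] = refl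
insertT-build x (h ∷ a) [] [] rewrite insertT-∷ x (h ∷ a) [] with x <? h
... | yes x<h rewrite rowInsert-bump a x<h = refl
... | no  x≮h rewrite rowInsert-skip a (≮⇒≥ x≮h) with proj₂ (rowInsert x a)
...   | nothing = refl
...   | just _  = refl

LowerRows : Tableau → Set
LowerRows = All (λ r → Sorted r × All (3 ≤_) r)

record WellFormed (a d : List ℕ) (rs : Tableau) : Set where
  field
    sorted₁      : Sorted a
    ≥1           : All (1 ≤_) a
    sorted₂      : Sorted d
    ≥2           : All (2 ≤_) d
    columnStrict : ColumnStrict a d
    lowerRows    : LowerRows rs

data Admissible : Tableau → Set where
  admissible : ∀ {a d rs} → WellFormed a d rs → Admissible (build a d rs)

Admissible-[] : Admissible []
Admissible-[] = admissible {[]} {[]} {[]} record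
  { sorted₁ = [] ; ≥1 = [] ; sorted₂ = [] ; ≥2 = [] ; columnStrict = tt ; lowerRows = [] }

insertMaybe-lowerRows : ∀ {m} rs → Maybe.All (3 ≤_) m → LowerRows rs → LowerRows (insertMaybe m rs)
insertT-lowerRows     : ∀ {z} rs → 3 ≤ z → LowerRows rs → LowerRows (insertT z rs)

insertMaybe-lowerRows rs Maybe.nothing      ok = ok
insertMaybe-lowerRows rs (Maybe.just 3≤y) ok = insertT-lowerRows rs 3≤y ok

insertT-lowerRows         []       3≤z []                = ([] ∷ [] , 3≤z ∷ []) ∷ []
insertT-lowerRows {z} (r ∷ rs) 3≤z ((sr , 3≤r) ∷ ok) rewrite insertT-∷ z r rs =
  (rowInsert-sorted z r sr , rowInsert-All z r 3≤r 3≤z) ∷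
  insertMaybe-lowerRows rs (Maybe.map (λ z<y → ≤-trans 3≤z (<⇒≤ z<y)) (bumped-> z r)) ok

rowInsertMaybe-sorted : ∀ m r → Sorted r → Sorted (proj₁ (rowInsertMaybe m r))
rowInsertMaybe-sorted nothing  r s = s
rowInsertMaybe-sorted (just y) r s = rowInsert-sorted y r s

rowInsertMaybe-All : ∀ {Q : ℕ → Set} m r → All Q r → Maybe.All Q m → All Q (proj₁ (rowInsertMaybe m r))
rowInsertMaybe-All nothing  r qr _               = qr
rowInsertMaybe-All (just y) r qr (Maybe.just qy) = rowInsert-All y r qr qy

rowInsertMaybe-> : ∀ {k} m r → Maybe.All (k ≤_) m → Maybe.All (k <_) (proj₂ (rowInsertMaybe m r))
rowInsertMaybe-> nothing  r _                = Maybe.nothing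
rowInsertMaybe-> (just y) r (Maybe.just k≤y) = Maybe.map (≤-<-trans k≤y) (bumped-> y r)

rowInsert-ColumnStrict : ∀ x s u → ColumnStrict s u →
                         Maybe.All (λ _ → ColumnStrict (proj₁ (rowInsert x s)) u) (proj₂ (rowInsert x s))
rowInsert-ColumnStrict x []      u       _          = Maybe.nothing
rowInsert-ColumnStrict x (t ∷ s) []      _          = Maybe.map (λ _ → tt) (bumped-> x (t ∷ s))
rowInsert-ColumnStrict x (t ∷ s) (b ∷ u) (t<b , cs) with x <? t
... | yes x<t rewrite rowInsert-bump s x<t = Maybe.just (<-trans x<t t<b , cs)
... | no  x≮t rewrite rowInsert-skip s (≮⇒≥ x≮t) = Maybe.map (t<b ,_) (rowInsert-ColumnStrict x s u cs)

insert₂-ColumnStrict : ∀ x a d → ColumnStrict a d →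
                       ColumnStrict (proj₁ (insert₂ x a d)) (proj₁ (proj₂ (insert₂ x a d)))
insert₂-ColumnStrict x []      []      _ = tt
insert₂-ColumnStrict x (t ∷ s) []      _ = by-bumped (rowInsert x (t ∷ s)) (bumped-> x (t ∷ s)) (bumped-head x (t ∷ s))
  where
  by-bumped : ∀ p → Maybe.All (x <_) (proj₂ p) → Maybe.All (λ _ → Any (_≤ x) (head (proj₁ p))) (proj₂ p) →
           ColumnStrict (proj₁ p) (proj₁ (rowInsertMaybe (proj₂ p) []))
  by-bumped (_ , nothing) _ _ = tt
  by-bumped (h ∷ _ , just y) (Maybe.just x<y) (Maybe.just (just h≤x)) = ≤-<-trans h≤x x<y , tt
insert₂-ColumnStrict x (t ∷ s) (b ∷ u) (t<b , cs) with x <? t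
... | yes x<t rewrite rowInsert-bump s x<t | rowInsert-bump u t<b = x<t , cs
... | no  x≮t rewrite rowInsert-skip s (≮⇒≥ x≮t) =
  by-bumped (rowInsert x s) refl (bumped-> x s) (insert₂-ColumnStrict x s u cs)
  where
  by-bumped : ∀ p → p ≡ rowInsert x s → Maybe.All (x <_) (proj₂ p) →
           ColumnStrict (proj₁ p) (proj₁ (rowInsertMaybe (proj₂ p) u)) →
           ColumnStrict (t ∷ proj₁ p) (proj₁ (rowInsertMaybe (proj₂ p) (b ∷ u)))
  by-bumped (_ , nothing) _ _ ih = t<b , ih
  by-bumped (_ , just y) eq (Maybe.just x<y) ih with y <? b
  ... | yes y<b rewrite rowInsert-bump u y<b =
    ≤-<-trans (≮⇒≥ x≮t) x<y ,
    Maybe.drop-just (subst (λ p → Maybe.All (λ _ → ColumnStrict (proj₁ p) u) (proj₂ p)) (sym eq)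
                           (rowInsert-ColumnStrict x s u cs))
  ... | no  y≮b rewrite rowInsert-skip u (≮⇒≥ y≮b) = t<b , ih

WellFormed-insert₂ : ∀ {x a d rs} → 1 ≤ x → WellFormed a d rs →
  WellFormed (proj₁ (insert₂ x a d)) (proj₁ (proj₂ (insert₂ x a d)))
             (insertMaybe (proj₂ (proj₂ (insert₂ x a d))) rs)
WellFormed-insert₂ {x} {a} {d} {rs} 1≤x wf = record
  { sorted₁      = rowInsert-sorted x a sorted₁
  ; ≥1          = rowInsert-All x a ≥1 1≤x
  ; sorted₂      = rowInsertMaybe-sorted m d sorted₂
  ; ≥2          = rowInsertMaybe-All m d ≥2 2≤m
  ; columnStrict = insert₂-ColumnStrict x a d columnStrict
  ; lowerRows    = insertMaybe-lowerRows rs (rowInsertMaybe-> m d 2≤m) lowerRows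
  }
  where
  open WellFormed wf
  m = proj₂ (rowInsert x a)
  2≤m : Maybe.All (2 ≤_) m
  2≤m = Maybe.map (≤-<-trans 1≤x) (bumped-> x a)

Admissible-insertT : ∀ {x T} → 1 ≤ x → Admissible T → Admissible (insertT x T)
Admissible-insertT {x} 1≤x (admissible {a} {d} {rs} wf) =
  subst Admissible (sym (insertT-build x a d rs)) (admissible (WellFormed-insert₂ 1≤x wf))

Admissible-insertWord : ∀ {T} w → PositiveWord w → Admissible T → Admissible (insertWord T w)
Admissible-insertWord []      []          adm = adm
Admissible-insertWord (x ∷ w) (1≤x ∷ pw) adm = Admissible-insertWord w pw (Admissible-insertT 1≤x adm)

Admissible-P : ∀ w → PositiveWord w → Admissible (P w)
Admissible-P w pw = Admissible-insertWord w pw Admissible-[]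

-- Left insertion of the letters 1 and 2

leftInsert₁ : Tableau → Tableau
leftInsert₁ []       = (1 ∷ []) ∷ []
leftInsert₁ (r ∷ rs) = (1 ∷ r) ∷ rs

-- P (2 ∷ w) from P w: 2 goes in front of the second row, below an empty cell in front of the first,
-- and the empty cell is slid out.
leftInsert₂ : Tableau → Tableau
leftInsert₂ T = build (proj₁ (slide (row₁ T) (2 ∷ row₂ T))) (proj₂ (slide (row₁ T) (2 ∷ row₂ T))) (rows₃ T)

leftInsert₂-build : ∀ a d rs →
                    leftInsert₂ (build a d rs) ≡ build (proj₁ (slide a (2 ∷ d))) (proj₂ (slide a (2 ∷ d))) rs
leftInsert₂-build a d rs =
  cong (λ (a , d , rs) → build (proj₁ (slide a (2 ∷ d))) (proj₂ (slide a (2 ∷ d))) rs) (split-build a d rs)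

insertT-leftInsert₁ : ∀ {x} T → 1 ≤ x → insertT x (leftInsert₁ T) ≡ leftInsert₁ (insertT x T)
insertT-leftInsert₁ {x} []       1≤x rewrite insertT-∷ x (1 ∷ []) [] | rowInsert-skip [] 1≤x = refl
insertT-leftInsert₁ {x} (r ∷ rs) 1≤x
  rewrite insertT-∷ x (1 ∷ r) rs | rowInsert-skip r 1≤x | insertT-∷ x r rs = refl

insertT-leftInsert₂ : ∀ {x T} → 1 ≤ x → Admissible T → insertT x (leftInsert₂ T) ≡ leftInsert₂ (insertT x T)
insertT-leftInsert₂ {x} 1≤x (admissible {a} {d} {rs} wf) = begin
  insertT x (leftInsert₂ (build a d rs))              ≡⟨ cong (insertT x) (leftInsert₂-build a d rs) ⟩
  insertT x (build a₀ d₀ rs)                           ≡⟨ insertT-build x a₀ d₀ rs ⟩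
  assemble (insert₂ x a₀ d₀) rs
    ≡⟨ cong (λ X → assemble X rs) (insert₂-slide x a (2 ∷ d) sorted₁ (≥2 ∷ sorted₂) columnStrict) ⟩
  assemble (slide₂ (a₁ , rowInsertMaybe m (2 ∷ d))) rs
    ≡⟨ cong (λ X → assemble (slide₂ (a₁ , X)) rs) (rowInsertMaybe-skip m d 2≤m) ⟩
  assemble (slide₂ (a₁ , 2 ∷ d₁ , m₁)) rs              ≡⟨ leftInsert₂-build a₁ d₁ (insertMaybe m₁ rs) ⟨
  leftInsert₂ (assemble (insert₂ x a d) rs)            ≡⟨ cong leftInsert₂ (insertT-build x a d rs) ⟨
  leftInsert₂ (insertT x (build a d rs))               ∎
  where
  open ≡-Reasoning
  open WellFormed wf
  a₀ = proj₁ (slide a (2 ∷ d))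
  d₀ = proj₂ (slide a (2 ∷ d))
  a₁ = proj₁ (rowInsert x a)
  m  = proj₂ (rowInsert x a)
  d₁ = proj₁ (rowInsertMaybe m d)
  m₁ = proj₂ (rowInsertMaybe m d)
  2≤m : Maybe.All (2 ≤_) m
  2≤m = Maybe.map (≤-<-trans 1≤x) (bumped-> x a)

Small : ℕ → Set
Small x = x ≡ 1 ⊎ x ≡ 2

Small⇒1≤ : ∀ {x} → Small x → 1 ≤ x
Small⇒1≤ (inj₁ refl) = s≤s z≤n
Small⇒1≤ (inj₂ refl) = s≤s z≤n

Small⇒≤2 : ∀ {x} → Small x → x ≤ 2
Small⇒≤2 (inj₁ refl) = s≤s z≤n
Small⇒≤2 (inj₂ refl) = s≤s (s≤s z≤n)

All-Small⇒PositiveWord : ∀ {u} → All Small u → PositiveWord u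
All-Small⇒PositiveWord = All.map Small⇒1≤

-- Only meaningful for the letters 1 and 2.
leftInsert : ℕ → Tableau → Tableau
leftInsert 1 = leftInsert₁
leftInsert _ = leftInsert₂

insertT-leftInsert : ∀ {a x T} → Small a → 1 ≤ x → Admissible T →
                     insertT x (leftInsert a T) ≡ leftInsert a (insertT x T)
insertT-leftInsert {T = T} (inj₁ refl) 1≤x _   = insertT-leftInsert₁ T 1≤x
insertT-leftInsert         (inj₂ refl) 1≤x adm = insertT-leftInsert₂ 1≤x adm

insertWord-leftInsert : ∀ {a T} → Small a → ∀ w → PositiveWord w → Admissible T →
                        insertWord (leftInsert a T) w ≡ leftInsert a (insertWord T w)
insertWord-leftInsert sa []      []          _   = refl
insertWord-leftInsert sa (x ∷ w) (1≤x ∷ pw) adm =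
  trans (cong (λ S → insertWord S w) (insertT-leftInsert sa 1≤x adm))
        (insertWord-leftInsert sa w pw (Admissible-insertT 1≤x adm))

P-∷ : ∀ {a} w → Small a → PositiveWord w → P (a ∷ w) ≡ leftInsert a (P w)
P-∷ w sa@(inj₁ refl) pw = insertWord-leftInsert sa w pw Admissible-[]
P-∷ w sa@(inj₂ refl) pw = insertWord-leftInsert sa w pw Admissible-[]

leftInsertWord : Word → Tableau → Tableau
leftInsertWord u T = foldr leftInsert T u

P-++-leftInsertWord : ∀ {u} x → All Small u → PositiveWord x → P (u ++ x) ≡ leftInsertWord u (P x)
P-++-leftInsertWord x []                 _  = refl
P-++-leftInsertWord x (_∷_ {a} {u} sa su) px =
  trans (P-∷ (u ++ x) sa (++⁺ (All-Small⇒PositiveWord su) px)) (cong (leftInsert a) (P-++-leftInsertWord x su px))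

P-++-congˡ : ∀ {u x y} → All Small u → PositiveWord x → PositiveWord y → P x ≡ P y → P (u ++ x) ≡ P (u ++ y)
P-++-congˡ {u} {x} {y} su px py eq = begin
  P (u ++ x)              ≡⟨ P-++-leftInsertWord x su px ⟩
  leftInsertWord u (P x)  ≡⟨ cong (leftInsertWord u) eq ⟩
  leftInsertWord u (P y)  ≡⟨ P-++-leftInsertWord y su py ⟨
  P (u ++ y)              ∎
  where open ≡-Reasoning

P-++-congʳ : ∀ {x y} v → P x ≡ P y → P (x ++ v) ≡ P (y ++ v)
P-++-congʳ {x} {y} v eq = begin
  P (x ++ v)          ≡⟨ P-++ x v ⟩
  insertWord (P x) v  ≡⟨ cong (λ T → insertWord T v) eq ⟩
  insertWord (P y) v  ≡⟨ P-++ y v ⟨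
  P (y ++ v)          ∎
  where open ≡-Reasoning

-- Large letters and their weight

large : List ℕ → List ℕ
large = filter (3 ≤?_)

#large : List ℕ → ℕ
#large = count (3 ≤?_)

large-small : ∀ {x} l → x ≤ 2 → large (x ∷ l) ≡ large l
large-small l x≤2 = filter-reject (3 ≤?_) (<⇒≱ (s≤s x≤2))

large-large : ∀ {x} l → 3 ≤ x → large (x ∷ l) ≡ x ∷ large l
large-large l 3≤x = filter-accept (3 ≤?_) 3≤x

#large-small : ∀ {x} l → x ≤ 2 → #large (x ∷ l) ≡ #large l
#large-small l x≤2 = cong length (large-small l x≤2)

#large-large : ∀ {x} l → 3 ≤ x → #large (x ∷ l) ≡ suc (#large l)
#large-large l 3≤x = cong length (large-large l 3≤x)

rowInsert-large : ∀ x r → x ≤ 2 → Maybe.All (_≤ 2) (proj₂ (rowInsert x r)) →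
                  large (proj₁ (rowInsert x r)) ≡ large r
rowInsert-large x []       x≤2 _ = large-small [] x≤2
rowInsert-large x (y ∷ ys) x≤2 y≤2 with x <? y
... | yes x<y rewrite rowInsert-bump ys x<y =
  trans (large-small ys x≤2) (sym (large-small ys (Maybe.drop-just y≤2)))
... | no  x≮y rewrite rowInsert-skip ys (≮⇒≥ x≮y) =
  trans (large-small _ y≤2′) (trans (rowInsert-large x ys x≤2 y≤2) (sym (large-small ys y≤2′)))
  where
  y≤2′ : y ≤ 2
  y≤2′ = ≤-trans (≮⇒≥ x≮y) x≤2

#large-+-[large] : ∀ {z} l → 3 ≤ z → #large l + #large (z ∷ []) ≡ suc (#large l)
#large-+-[large] l 3≤z = trans (cong (#large l +_) (#large-large [] 3≤z)) (+-comm (#large l) 1)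

weightFrom : ℕ → Tableau → ℕ
weightFrom i []       = 0
weightFrom i (r ∷ rs) = i * #large r + weightFrom (suc i) rs

weightFrom-insertT : ∀ i y rs → 3 ≤ y → i + weightFrom i rs ≤ weightFrom i (insertT y rs)
weightFrom-insertT i y []       3≤y rewrite #large-large [] 3≤y | *-identityʳ i = ≤-refl
weightFrom-insertT i y (r ∷ rs) 3≤y rewrite insertT-∷ y r rs =
  by-bumped (rowInsert y r) (trans (rowInsert-count (3 ≤?_) y r) (#large-large r 3≤y)) (bumped-> y r)
  where
  W = weightFrom (suc i) rs
  by-bumped : ∀ p → #large (proj₁ p) + #large (fromMaybe (proj₂ p)) ≡ suc (#large r) → Maybe.All (y <_) (proj₂ p) →
           i + (i * #large r + W) ≤ i * #large (proj₁ p) + weightFrom (suc i) (insertMaybe (proj₂ p) rs)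
  by-bumped (r′ , nothing) e _ rewrite +-identityʳ (#large r′) | e =
    ≤-reflexive (trans (sym (+-assoc i (i * #large r) W)) (cong (_+ W) (sym (*-suc i (#large r)))))
  by-bumped (r′ , just z) e (Maybe.just y<z)
    rewrite suc-injective (trans (sym (#large-+-[large] r′ (≤-trans 3≤y (<⇒≤ y<z)))) e) =
    ≤-trans (≤-reflexive (x∙yz≈y∙xz i (i * #large r) W))
            (+-monoʳ-≤ (i * #large r) (≤-trans (n≤1+n (i + W)) (weightFrom-insertT (suc i) z rs 3≤z)))
    where
    3≤z : 3 ≤ z
    3≤z = ≤-trans 3≤y (<⇒≤ y<z)

largeRows : Rows → Rows
largeRows (a , d , rs) = large a , large d , rs

weight : Rows → ℕ
weight (a , d , rs) = #large a + weightFrom 2 (d ∷ rs)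

weight-largeRows : ∀ X Y → largeRows X ≡ largeRows Y → weight X ≡ weight Y
weight-largeRows _ _ = cong (λ (a , d , rs) → length a + (2 * length d + weightFrom 3 rs))

-- Moving large letters to lower rows makes a tableau heavier.
data _≼_ (X Y : Rows) : Set where
  same    : largeRows X ≡ largeRows Y → X ≼ Y
  lighter : weight X < weight Y → X ≼ Y

≼-refl : ∀ {X} → X ≼ X
≼-refl = same refl

≼⇒≤ : ∀ {X Y} → X ≼ Y → weight X ≤ weight Y
≼⇒≤ {X} {Y} (same eq)  = ≤-reflexive (weight-largeRows X Y eq)
≼⇒≤         (lighter l) = <⇒≤ l

≼-trans : ∀ {X Y Z} → X ≼ Y → Y ≼ Z → X ≼ Z
≼-trans         (same e)    (same e′)    = same (trans e e′)
≼-trans {X} {Y} {Z} (same e) (lighter l) = lighter (subst (_< weight Z) (sym (weight-largeRows X Y e)) l)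
≼-trans         (lighter l) Y≼Z          = lighter (<-≤-trans l (≼⇒≤ Y≼Z))

≼-antisym : ∀ {X Y} → X ≼ Y → Y ≼ X → largeRows X ≡ largeRows Y
≼-antisym (same e)    _   = e
≼-antisym (lighter l) Y≼X = ⊥-elim (<⇒≱ l (≼⇒≤ Y≼X))

≼-2-into-row₂ : ∀ {a a′} d rs → large a′ ≡ large a →
                (a , d , rs) ≼ (a′ , proj₁ (rowInsert 2 d) , insertMaybe (proj₂ (rowInsert 2 d)) rs)
≼-2-into-row₂ {a} {a′} d rs large-a =
  by-bumped (rowInsert 2 d) (trans (rowInsert-count (3 ≤?_) 2 d) (#large-small d ≤-refl)) (bumped-> 2 d)
         (rowInsert-large 2 d ≤-refl)
  where
  by-bumped : ∀ q → #large (proj₁ q) + #large (fromMaybe (proj₂ q)) ≡ #large d → Maybe.All (2 <_) (proj₂ q) →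
           (Maybe.All (_≤ 2) (proj₂ q) → large (proj₁ q) ≡ large d) →
           (a , d , rs) ≼ (a′ , proj₁ q , insertMaybe (proj₂ q) rs)
  by-bumped (d′ , nothing) _ _ large-d =
    same (cong₂ (λ l l′ → l , l′ , rs) (sym large-a) (sym (large-d Maybe.nothing)))
  by-bumped (d′ , just z) e (Maybe.just 3≤z) _ = lighter (begin-strict
    #large a + (2 * #large d + W)          ≡⟨ cong₂ (λ m n → m + (2 * n + W)) (cong length large-a) e′ ⟨
    #large a′ + (2 * suc (#large d′) + W)
      <⟨ +-monoʳ-< (#large a′) (≤-reflexive (2[1+n]+w≡2n+[3+w] (#large d′) W)) ⟩
    #large a′ + (2 * #large d′ + (3 + W))
      ≤⟨ +-monoʳ-≤ (#large a′) (+-monoʳ-≤ (2 * #large d′) (weightFrom-insertT 3 z rs 3≤z)) ⟩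
    #large a′ + (2 * #large d′ + weightFrom 3 (insertT z rs)) ∎)
    where
    open ≤-Reasoning
    W = weightFrom 3 rs
    e′ : suc (#large d′) ≡ #large d
    e′ = trans (sym (#large-+-[large] d′ 3≤z)) e
    2[1+n]+w≡2n+[3+w] : ∀ n w → suc (2 * suc n + w) ≡ 2 * n + (3 + w)
    2[1+n]+w≡2n+[3+w] = solve-∀

≼-large-into-row₂ : ∀ {a a′ y} d rs → suc (#large a′) ≡ #large a → 3 ≤ y →
                    (a , d , rs) ≼ (a′ , proj₁ (rowInsert y d) , insertMaybe (proj₂ (rowInsert y d)) rs)
≼-large-into-row₂ {a} {a′} {y} d rs e 3≤y = lighter (begin-strict
  #large a + W                                  ≡⟨ cong (_+ W) (sym e) ⟩
  suc (#large a′) + W                           ≡⟨ +-suc (#large a′) W ⟨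
  #large a′ + suc W                             <⟨ +-monoʳ-< (#large a′) (n<1+n (suc W)) ⟩
  #large a′ + (2 + W)                           ≤⟨ +-monoʳ-≤ (#large a′) (weightFrom-insertT 2 y (d ∷ rs) 3≤y) ⟩
  #large a′ + weightFrom 2 (insertT y (d ∷ rs)) ≡⟨ cong (λ T → #large a′ + weightFrom 2 T) (insertT-∷ y d rs) ⟩
  weight (a′ , proj₁ (rowInsert y d) , insertMaybe (proj₂ (rowInsert y d)) rs) ∎)
  where
  open ≤-Reasoning
  W = weightFrom 2 (d ∷ rs)

insert₂-≽ : ∀ {x} a d rs → Small x →
  (a , d , rs) ≼ (proj₁ (insert₂ x a d) , proj₁ (proj₂ (insert₂ x a d)) ,
                  insertMaybe (proj₂ (proj₂ (insert₂ x a d))) rs)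
insert₂-≽ {x} a d rs sx =
  by-bumped (rowInsert x a) (trans (rowInsert-count (3 ≤?_) x a) (#large-small a (Small⇒≤2 sx)))
         (bumped-> x a) (rowInsert-large x a (Small⇒≤2 sx))
  where
  by-bumped : ∀ p → #large (proj₁ p) + #large (fromMaybe (proj₂ p)) ≡ #large a → Maybe.All (x <_) (proj₂ p) →
           (Maybe.All (_≤ 2) (proj₂ p) → large (proj₁ p) ≡ large a) →
           (a , d , rs) ≼ (proj₁ p , proj₁ (rowInsertMaybe (proj₂ p) d) ,
                           insertMaybe (proj₂ (rowInsertMaybe (proj₂ p) d)) rs)
  by-bumped (a′ , nothing) _ _ large-a = same (cong (λ l → l , large d , rs) (sym (large-a Maybe.nothing)))
  by-bumped (a′ , just y) e (Maybe.just x<y) large-a with y ≤? 2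
  ... | yes y≤2 with refl ← ≤-antisym y≤2 (≤-<-trans (Small⇒1≤ sx) x<y) =
    ≼-2-into-row₂ d rs (large-a (Maybe.just y≤2))
  ... | no  y≰2 = ≼-large-into-row₂ d rs (trans (sym (#large-+-[large] a′ (≰⇒> y≰2))) e) (≰⇒> y≰2)

_⊑_ : Tableau → Tableau → Set
T ⊑ T′ = split T ≼ split T′

⊑-insertT : ∀ {x T} → Small x → Admissible T → T ⊑ insertT x T
⊑-insertT {x} sx (admissible {a} {d} {rs} _) =
  subst₂ _≼_ (sym (split-build a d rs))
             (sym (trans (cong split (insertT-build x a d rs)) (split-build _ _ _)))
             (insert₂-≽ a d rs sx)

split-leftInsert₁ : ∀ T → split (leftInsert₁ T) ≡ (1 ∷ row₁ T , row₂ T , rows₃ T)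
split-leftInsert₁ []             = refl
split-leftInsert₁ (_ ∷ [])       = refl
split-leftInsert₁ (_ ∷ _ ∷ _)    = refl

leftInsert₁-⊑ : ∀ T → leftInsert₁ T ⊑ T
leftInsert₁-⊑ T rewrite split-leftInsert₁ T =
  same (cong (λ l → l , large (row₂ T) , rows₃ T) (large-small (row₁ T) (s≤s z≤n)))

large-moveUp : ∀ c r B → (large (c ∷ r) ≡ large r × large B ≡ large (c ∷ B))
                       ⊎ (#large (c ∷ r) ≡ suc (#large r) × suc (#large B) ≡ #large (c ∷ B))
large-moveUp c r B with c ≤? 2
... | yes c≤2 = inj₁ (large-small r c≤2 , sym (large-small B c≤2))
... | no  c≰2 = inj₂ (#large-large r (≰⇒> c≰2) , sym (#large-large B (≰⇒> c≰2)))

large-∷-cong : ∀ x {l l′} → large l ≡ large l′ → large (x ∷ l) ≡ large (x ∷ l′)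
large-∷-cong x {l} {l′} e =
  trans (filter-++ (3 ≤?_) (x ∷ []) l) (trans (cong (large (x ∷ []) ++_) e) (sym (filter-++ (3 ≤?_) (x ∷ []) l′)))

#large-∷-suc : ∀ x {l l′} → #large l ≡ suc (#large l′) → #large (x ∷ l) ≡ suc (#large (x ∷ l′))
#large-∷-suc x {l} {l′} e = begin
  #large (x ∷ l)                  ≡⟨ count-++ (3 ≤?_) (x ∷ []) l ⟩
  #large (x ∷ []) + #large l      ≡⟨ cong (#large (x ∷ []) +_) e ⟩
  #large (x ∷ []) + suc (#large l′) ≡⟨ +-suc (#large (x ∷ [])) (#large l′) ⟩
  suc (#large (x ∷ []) + #large l′) ≡⟨ cong suc (count-++ (3 ≤?_) (x ∷ []) l′) ⟨
  suc (#large (x ∷ l′))           ∎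
  where open ≡-Reasoning

slide-large : ∀ r B → (large (proj₁ (slide r B)) ≡ large r × large (proj₂ (slide r B)) ≡ large B)
                    ⊎ (#large (proj₁ (slide r B)) ≡ suc (#large r) × suc (#large (proj₂ (slide r B))) ≡ #large B)
slide-large r       []      = inj₁ (refl , refl)
slide-large []      (c ∷ B) = large-moveUp c [] B
slide-large (t ∷ r) (c ∷ B) with c ≤? t
... | yes _ = large-moveUp c (t ∷ r) B
... | no  _ with slide-large r B
...   | inj₁ (e₁ , e₂) = inj₁ (large-∷-cong t e₁ , large-∷-cong c e₂)
...   | inj₂ (e₁ , e₂) = inj₂ (#large-∷-suc t e₁ , sym (#large-∷-suc c (sym e₂)))

leftInsert₂-⊑ : ∀ T → leftInsert₂ T ⊑ T
leftInsert₂-⊑ T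
  rewrite split-build (proj₁ (slide (row₁ T) (2 ∷ row₂ T))) (proj₂ (slide (row₁ T) (2 ∷ row₂ T))) (rows₃ T)
  with slide-large (row₁ T) (2 ∷ row₂ T)
... | inj₁ (e₁ , e₂) =
  same (cong₂ (λ l l′ → l , l′ , rows₃ T) e₁ (trans e₂ (large-small (row₂ T) ≤-refl)))
... | inj₂ (e₁ , e₂) = lighter (≤-reflexive (begin
  suc (#large a′ + (2 * #large d′ + W))    ≡⟨ cong (λ n → suc (n + (2 * #large d′ + W))) e₁ ⟩
  suc (suc (#large a) + (2 * #large d′ + W)) ≡⟨ 2+[1+a+[2d+w]]≡a+[2[1+d]+w] (#large a) (#large d′) W ⟩
  #large a + (2 * suc (#large d′) + W)
    ≡⟨ cong (λ n → #large a + (2 * n + W)) (trans e₂ (#large-small (row₂ T) ≤-refl)) ⟩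
  #large a + (2 * #large (row₂ T) + W)     ∎))
  where
  open ≡-Reasoning
  a  = row₁ T
  a′ = proj₁ (slide (row₁ T) (2 ∷ row₂ T))
  d′ = proj₂ (slide (row₁ T) (2 ∷ row₂ T))
  W  = weightFrom 3 (rows₃ T)
  2+[1+a+[2d+w]]≡a+[2[1+d]+w] : ∀ a d w → suc (suc a + (2 * d + w)) ≡ a + (2 * suc d + w)
  2+[1+a+[2d+w]]≡a+[2[1+d]+w] = solve-∀

leftInsert-⊑ : ∀ {a} T → Small a → leftInsert a T ⊑ T
leftInsert-⊑ T (inj₁ refl) = leftInsert₁-⊑ T
leftInsert-⊑ T (inj₂ refl) = leftInsert₂-⊑ T

-- Occurrences of the letters 1 and 2

occurrences : ℕ → List ℕ → ℕ
occurrences k = count (k ≟_)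

occurrences-hit : ∀ k l → occurrences k (k ∷ l) ≡ suc (occurrences k l)
occurrences-hit k l = cong length (filter-accept (k ≟_) refl)

occurrences-miss : ∀ {k x} l → k ≢ x → occurrences k (x ∷ l) ≡ occurrences k l
occurrences-miss {k} l k≢x = cong length (filter-reject (k ≟_) k≢x)

occurrences-> : ∀ {k} l → All (k <_) l → occurrences k l ≡ 0
occurrences-> {k} l k<l = cong length (filter-none (k ≟_) (All.map (λ k<e k≡e → <-irrefl k≡e k<e) k<l))

occurrences-fromMaybe : ∀ {k} m → Maybe.All (k <_) m → occurrences k (fromMaybe m) ≡ 0
occurrences-fromMaybe nothing  _                = refl
occurrences-fromMaybe (just y) (Maybe.just k<y) = occurrences-> (y ∷ []) (k<y ∷ [])

occurrences-All : ∀ {Q : ℕ → Set} {k} l → All Q l → 0 < occurrences k l → Q k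
occurrences-All     []      []        ()
occurrences-All {k = k} (x ∷ l) (qx ∷ ql) pos with k ≟ x
... | yes refl = qx
... | no  k≢x  = occurrences-All l ql (subst (0 <_) (occurrences-miss l k≢x) pos)

occurrences-rowInsert : ∀ k x r → Maybe.All (k <_) (proj₂ (rowInsert x r)) →
                        occurrences k (proj₁ (rowInsert x r)) ≡ occurrences k (x ∷ r)
occurrences-rowInsert k x r k<m = begin
  occurrences k (proj₁ (rowInsert x r))         ≡⟨ +-identityʳ _ ⟨
  occurrences k (proj₁ (rowInsert x r)) + 0
    ≡⟨ cong (occurrences k (proj₁ (rowInsert x r)) +_) (occurrences-fromMaybe _ k<m) ⟨
  occurrences k (proj₁ (rowInsert x r)) + occurrences k (fromMaybe (proj₂ (rowInsert x r)))
                                                ≡⟨ rowInsert-count (k ≟_) x r ⟩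
  occurrences k (x ∷ r)                         ∎
  where open ≡-Reasoning

occurrences-rowInsert-self : ∀ k r → occurrences k (proj₁ (rowInsert k r)) ≡ suc (occurrences k r)
occurrences-rowInsert-self k r = trans (occurrences-rowInsert k k r (bumped-> k r)) (occurrences-hit k r)

occurrences-rowInsert-< : ∀ {k x} r → k < x → occurrences k (proj₁ (rowInsert x r)) ≡ occurrences k r
occurrences-rowInsert-< {k} {x} r k<x =
  trans (occurrences-rowInsert k x r (Maybe.map (<-trans k<x) (bumped-> x r))) (occurrences-miss r (<⇒≢ k<x))

occurrences-rowInsertMaybe : ∀ {k} m r → Maybe.All (k <_) m →
                             occurrences k (proj₁ (rowInsertMaybe m r)) ≡ occurrences k r
occurrences-rowInsertMaybe nothing  r _                = refl
occurrences-rowInsertMaybe     (just y) r (Maybe.just k<y) = occurrences-rowInsert-< r k<y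

row₂-decomposition : ∀ r → Sorted r → All (2 ≤_) r → r ≡ replicate (occurrences 2 r) 2 ++ large r
row₂-decomposition []       _            _            = refl
row₂-decomposition (x ∷ xs) (x≤xs ∷ sxs) (2≤x ∷ 2≤xs) with x ≟ 2
... | yes refl rewrite occurrences-hit 2 xs | large-small xs (≤-refl {2}) =
  cong (2 ∷_) (row₂-decomposition xs sxs 2≤xs)
... | no  x≢2 = sym (cong₂ (λ n l → replicate n 2 ++ l) (occurrences-> (x ∷ xs) 2<) (filter-all (3 ≤?_) 2<))
  where
  2< : All (2 <_) (x ∷ xs)
  2< = ≤∧≢⇒< 2≤x (x≢2 ∘ sym) ∷ All.map (<-≤-trans (≤∧≢⇒< 2≤x (x≢2 ∘ sym))) x≤xs

row₁-decomposition : ∀ r → Sorted r → All (1 ≤_) r →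
                     r ≡ replicate (occurrences 1 r) 1 ++ replicate (occurrences 2 r) 2 ++ large r
row₁-decomposition []       _            _            = refl
row₁-decomposition (x ∷ xs) (x≤xs ∷ sxs) (1≤x ∷ 1≤xs) with x ≟ 1
... | yes refl rewrite occurrences-hit 1 xs | occurrences-miss {2} {1} xs (λ ()) | large-small xs (s≤s (z≤n {1})) =
  cong (1 ∷_) (row₁-decomposition xs sxs 1≤xs)
... | no  x≢1 =
  trans (row₂-decomposition (x ∷ xs) (x≤xs ∷ sxs) 1<)
        (cong (λ n → replicate n 1 ++ replicate (occurrences 2 (x ∷ xs)) 2 ++ large (x ∷ xs))
              (sym (occurrences-> (x ∷ xs) 1<)))
  where
  1< : All (1 <_) (x ∷ xs)
  1< = ≤∧≢⇒< 1≤x (x≢1 ∘ sym) ∷ All.map (<-≤-trans (≤∧≢⇒< 1≤x (x≢1 ∘ sym))) x≤xs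

counts : List ℕ → List ℕ → ℕ × ℕ × ℕ
counts a d = occurrences 1 a , occurrences 2 a , occurrences 2 d

countsᵀ : Tableau → ℕ × ℕ × ℕ
countsᵀ T = counts (row₁ T) (row₂ T)

countsᵀ-build : ∀ a d rs → countsᵀ (build a d rs) ≡ counts a d
countsᵀ-build a d rs = cong (λ (a , d , _) → counts a d) (split-build a d rs)

WellFormed-≡ : ∀ {a d rs a′ d′ rs′} → WellFormed a d rs → WellFormed a′ d′ rs′ →
               counts a d ≡ counts a′ d′ →
               largeRows (a , d , rs) ≡ largeRows (a′ , d′ , rs′) → build a d rs ≡ build a′ d′ rs′
WellFormed-≡ {a} {d} {rs} {a′} {d′} {rs′} wf wf′ eq-counts eq-large =
  cong₂ (λ a (d , rs) → build a d rs) a≡a′ (cong₂ _,_ d≡d′ (cong (proj₂ ∘ proj₂) eq-large))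
  where
  open WellFormed
  a≡a′ : a ≡ a′
  a≡a′ = begin
    a
      ≡⟨ row₁-decomposition a (sorted₁ wf) (≥1 wf) ⟩
    replicate (occurrences 1 a) 1 ++ replicate (occurrences 2 a) 2 ++ large a
      ≡⟨ cong₂ (λ m rest → replicate m 1 ++ rest) (cong proj₁ eq-counts)
               (cong₂ (λ n l → replicate n 2 ++ l) (cong (proj₁ ∘ proj₂) eq-counts) (cong proj₁ eq-large)) ⟩
    replicate (occurrences 1 a′) 1 ++ replicate (occurrences 2 a′) 2 ++ large a′
      ≡⟨ row₁-decomposition a′ (sorted₁ wf′) (≥1 wf′) ⟨
    a′
      ∎
    where open ≡-Reasoning
  d≡d′ : d ≡ d′
  d≡d′ = begin
    d                                           ≡⟨ row₂-decomposition d (sorted₂ wf) (≥2 wf) ⟩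
    replicate (occurrences 2 d) 2 ++ large d    ≡⟨ cong₂ (λ n l → replicate n 2 ++ l) (cong (proj₂ ∘ proj₂) eq-counts)
                                                         (cong (proj₁ ∘ proj₂) eq-large) ⟩
    replicate (occurrences 2 d′) 2 ++ large d′  ≡⟨ row₂-decomposition d′ (sorted₂ wf′) (≥2 wf′) ⟨
    d′                                          ∎
    where open ≡-Reasoning

Admissible-≡ : ∀ {T T′} → Admissible T → Admissible T′ → countsᵀ T ≡ countsᵀ T′ →
               largeRows (split T) ≡ largeRows (split T′) → T ≡ T′
Admissible-≡ (admissible {a} {d} {rs} wf) (admissible {a′} {d′} {rs′} wf′) eq-counts eq-large =
  WellFormed-≡ wf wf′
    (trans (sym (countsᵀ-build a d rs)) (trans eq-counts (countsᵀ-build a′ d′ rs′)))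
    (trans (sym (cong largeRows (split-build a d rs))) (trans eq-large (cong largeRows (split-build a′ d′ rs′))))

rowInsert-1-bumps-2 : ∀ a → Sorted a → 0 < occurrences 2 a → proj₂ (rowInsert 1 a) ≡ just 2
rowInsert-1-bumps-2 a sa pos with proj₂ (rowInsert 1 a) in eq
... | nothing = ⊥-elim (<-irrefl refl (occurrences-All a (unbumped⇒All≤ 1 a eq) pos))
... | just y  = cong just (≤-antisym y≤2 2≤y)
  where
  y≤2 : y ≤ 2
  y≤2 = occurrences-All a (Maybe.drop-just (subst (Maybe.All (λ y → All (λ e → 1 < e → y ≤ e) a)) eq
                                                   (bumped-leftmost 1 a sa))) pos ≤-refl
  2≤y : 2 ≤ y
  2≤y = Maybe.drop-just (subst (Maybe.All (1 <_)) eq (bumped-> 1 a))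

rowInsert-1-without-2 : ∀ a → occurrences 2 a ≡ 0 →
  occurrences 2 (proj₁ (rowInsert 1 a)) ≡ 0 × Maybe.All (2 <_) (proj₂ (rowInsert 1 a))
rowInsert-1-without-2 a no-2 =
  m+n≡0⇒m≡0 _ total ,
  bumped>2 (proj₂ (rowInsert 1 a)) (bumped-> 1 a) (m+n≡0⇒n≡0 (occurrences 2 (proj₁ (rowInsert 1 a))) total)
  where
  total : occurrences 2 (proj₁ (rowInsert 1 a)) + occurrences 2 (fromMaybe (proj₂ (rowInsert 1 a))) ≡ 0
  total = trans (rowInsert-count (2 ≟_) 1 a) (trans (occurrences-miss {2} {1} a (λ ())) no-2)
  bumped>2 : ∀ m → Maybe.All (1 <_) m → occurrences 2 (fromMaybe m) ≡ 0 → Maybe.All (2 <_) m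
  bumped>2 nothing  _                _ = Maybe.nothing
  bumped>2 (just y) (Maybe.just 1<y) e =
    Maybe.just (≤∧≢⇒< 1<y λ { refl → case trans (sym (occurrences-hit 2 [])) e of λ () })

stepCounts : ℕ → ℕ × ℕ × ℕ → ℕ × ℕ × ℕ
stepCounts 1 (a , zero  , c) = suc a , zero , c
stepCounts 1 (a , suc b , c) = suc a , b , suc c
stepCounts 2 (a , b , c)     = a , suc b , c
stepCounts _ s               = s

counts-insert₂-1 : ∀ a d → Sorted a → ∀ {n₁ n₂} → occurrences 1 a ≡ n₁ → occurrences 2 a ≡ n₂ →
  counts (proj₁ (insert₂ 1 a d)) (proj₁ (proj₂ (insert₂ 1 a d))) ≡ stepCounts 1 (n₁ , n₂ , occurrences 2 d)
counts-insert₂-1 a d sa {n₂ = zero} refl no-2 with rowInsert-1-without-2 a no-2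
... | row-no-2 , bumped>2 =
  cong₂ _,_ (occurrences-rowInsert-self 1 a) (cong₂ _,_ row-no-2 (occurrences-rowInsertMaybe _ d bumped>2))
counts-insert₂-1 a d sa {n₂ = suc b} refl has-2 = cong₂ _,_ (occurrences-rowInsert-self 1 a) (cong₂ _,_ row-2 row₂-2)
  where
  bumps-2 : proj₂ (rowInsert 1 a) ≡ just 2
  bumps-2 = rowInsert-1-bumps-2 a sa (subst (0 <_) (sym has-2) (s≤s z≤n))
  row-2 : occurrences 2 (proj₁ (rowInsert 1 a)) ≡ b
  row-2 = suc-injective (begin
    suc (occurrences 2 (proj₁ (rowInsert 1 a)))    ≡⟨ +-comm 1 _ ⟩
    occurrences 2 (proj₁ (rowInsert 1 a)) + occurrences 2 (fromMaybe (just 2))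
      ≡⟨ cong (λ m → occurrences 2 (proj₁ (rowInsert 1 a)) + occurrences 2 (fromMaybe m)) bumps-2 ⟨
    occurrences 2 (proj₁ (rowInsert 1 a)) + occurrences 2 (fromMaybe (proj₂ (rowInsert 1 a)))
      ≡⟨ rowInsert-count (2 ≟_) 1 a ⟩
    occurrences 2 (1 ∷ a)                          ≡⟨ occurrences-miss {2} {1} a (λ ()) ⟩
    occurrences 2 a                                ≡⟨ has-2 ⟩
    suc b                                          ∎)
    where open ≡-Reasoning
  row₂-2 : occurrences 2 (proj₁ (rowInsertMaybe (proj₂ (rowInsert 1 a)) d)) ≡ suc (occurrences 2 d)
  row₂-2 = trans (cong (λ m → occurrences 2 (proj₁ (rowInsertMaybe m d))) bumps-2) (occurrences-rowInsert-self 2 d)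

counts-insert₂ : ∀ l a d → 1 ≤ l → Sorted a →
  counts (proj₁ (insert₂ l a d)) (proj₁ (proj₂ (insert₂ l a d))) ≡ stepCounts l (counts a d)
counts-insert₂ 1 a d _ sa = counts-insert₂-1 a d sa refl refl
counts-insert₂ 2 a d _ sa =
  cong₂ _,_ (occurrences-rowInsert-< a ≤-refl)
            (cong₂ _,_ (occurrences-rowInsert-self 2 a) (occurrences-rowInsertMaybe _ d (bumped-> 2 a)))
counts-insert₂ l@(suc (suc (suc _))) a d _ sa =
  cong₂ _,_ (occurrences-rowInsert-< a (s≤s (s≤s z≤n)))
            (cong₂ _,_ (occurrences-rowInsert-< a (s≤s (s≤s (s≤s z≤n))))
                       (occurrences-rowInsertMaybe _ d (Maybe.map (<-trans (s≤s (s≤s (s≤s z≤n)))) (bumped-> l a))))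

-- Tableaux over the letters 1 and 2

-- (p , b , c) stands for the tableau with rows 1^(p + c) 2^b and 2^c.
Plac₂ : Set
Plac₂ = ℕ × ℕ × ℕ

toCounts : Plac₂ → ℕ × ℕ × ℕ
toCounts (p , b , c) = p + c , b , c

toCounts-injective : ∀ s t → toCounts s ≡ toCounts t → s ≡ t
toCounts-injective (p , b , c) (p′ , b′ , c′) eq
  with refl ← cong (proj₁ ∘ proj₂) eq | refl ← cong (proj₂ ∘ proj₂) eq =
  cong (_, b , c) (+-cancelʳ-≡ c p p′ (cong proj₁ eq))

insert₁₂ : ℕ → Plac₂ → Plac₂
insert₁₂ 1 (p , zero  , c) = suc p , zero , c
insert₁₂ 1 (p , suc b , c) = p , b , suc c
insert₁₂ 2 (p , b , c)     = p , suc b , c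
insert₁₂ _ s               = s

insertWord₁₂ : Plac₂ → Word → Plac₂
insertWord₁₂ = foldl (λ s x → insert₁₂ x s)

P₁₂ : Word → Plac₂
P₁₂ = insertWord₁₂ (0 , 0 , 0)

stepCounts-toCounts : ∀ l s → stepCounts l (toCounts s) ≡ toCounts (insert₁₂ l s)
stepCounts-toCounts 0                   s             = refl
stepCounts-toCounts 1                   (p , 0 , c)     = refl
stepCounts-toCounts 1                   (p , suc b , c) = cong (_, b , suc c) (sym (+-suc p c))
stepCounts-toCounts 2                   s             = refl
stepCounts-toCounts (suc (suc (suc _))) s             = refl

counts-insertT : ∀ {l T} → 1 ≤ l → Admissible T → countsᵀ (insertT l T) ≡ stepCounts l (countsᵀ T)
counts-insertT {l} 1≤l (admissible {a} {d} {rs} wf) = begin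
  countsᵀ (insertT l (build a d rs))                 ≡⟨ cong countsᵀ (insertT-build l a d rs) ⟩
  countsᵀ (assemble (insert₂ l a d) rs)              ≡⟨ countsᵀ-build a′ d′ (insertMaybe m′ rs) ⟩
  counts a′ d′                                       ≡⟨ counts-insert₂ l a d 1≤l (WellFormed.sorted₁ wf) ⟩
  stepCounts l (counts a d)                          ≡⟨ cong (stepCounts l) (countsᵀ-build a d rs) ⟨
  stepCounts l (countsᵀ (build a d rs))              ∎
  where
  open ≡-Reasoning
  a′ = proj₁ (insert₂ l a d)
  d′ = proj₁ (proj₂ (insert₂ l a d))
  m′ = proj₂ (proj₂ (insert₂ l a d))

counts-insertWord : ∀ {T s} w → PositiveWord w → Admissible T → countsᵀ T ≡ toCounts s →
                    countsᵀ (insertWord T w) ≡ toCounts (insertWord₁₂ s w)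
counts-insertWord         []      []          _   eq = eq
counts-insertWord {T} {s} (l ∷ w) (1≤l ∷ pw) adm eq =
  counts-insertWord w pw (Admissible-insertT 1≤l adm)
    (trans (counts-insertT 1≤l adm) (trans (cong (stepCounts l) eq) (stepCounts-toCounts l s)))

counts-P : ∀ w → PositiveWord w → countsᵀ (P w) ≡ toCounts (P₁₂ w)
counts-P w pw = counts-insertWord w pw Admissible-[] refl

-- The free 2s of the left factor pair with the free 1s of the right factor into b ⊓ p′ new columns.
_·_ : Plac₂ → Plac₂ → Plac₂
(p , b , c) · (p′ , b′ , c′) = p + (p′ ∸ (b ⊓ p′)) , (b ∸ (b ⊓ p′)) + b′ , c + c′ + (b ⊓ p′)

·-identityʳ : ∀ s → s · (0 , 0 , 0) ≡ s
·-identityʳ (p , b , c) rewrite ⊓-zeroʳ b | +-identityʳ p | +-identityʳ b | +-identityʳ c | +-identityʳ c = refl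

insert₁₂-· : ∀ l s t → insert₁₂ l (s · t) ≡ s · insert₁₂ l t
insert₁₂-· 0                   s           t                = refl
insert₁₂-· (suc (suc (suc _))) s           t                = refl
insert₁₂-· 2                   (p , b , c) (p′ , b′ , c′)   =
  cong (λ x → p + (p′ ∸ (b ⊓ p′)) , x , c + c′ + (b ⊓ p′)) (sym (+-suc (b ∸ (b ⊓ p′)) b′))
insert₁₂-· 1                   (p , b , c) (p′ , suc b′ , c′)
  rewrite +-suc (b ∸ (b ⊓ p′)) b′ =
  cong (λ x → p + (p′ ∸ (b ⊓ p′)) , (b ∸ (b ⊓ p′)) + b′ , x + (b ⊓ p′)) (sym (+-suc c c′))
insert₁₂-· 1                   (p , b , c) (p′ , zero , c′) with b ≤? p′
... | yes b≤p′ rewrite m≤n⇒m⊓n≡m b≤p′ | m≤n⇒m⊓n≡m (m≤n⇒m≤1+n b≤p′) | n∸n≡0 b =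
  cong (λ x → x , 0 , c + c′ + b) (trans (sym (+-suc p (p′ ∸ b))) (cong (p +_) (sym (+-∸-assoc 1 b≤p′))))
... | no  b≰p′ rewrite m≥n⇒m⊓n≡n (<⇒≤ (≰⇒> b≰p′)) | m≥n⇒m⊓n≡n (≰⇒> b≰p′) | +-∸-assoc 1 (≰⇒> b≰p′) =
  cong (λ x → p + (p′ ∸ p′) , (b ∸ suc p′) + 0 , x) (sym (+-suc (c + c′) p′))

insertWord₁₂-· : ∀ w s t → insertWord₁₂ (s · t) w ≡ s · insertWord₁₂ t w
insertWord₁₂-· []      s t = refl
insertWord₁₂-· (l ∷ w) s t =
  trans (cong (λ q → insertWord₁₂ q w) (insert₁₂-· l s t)) (insertWord₁₂-· w s (insert₁₂ l t))

P₁₂-++ : ∀ x v → P₁₂ (x ++ v) ≡ P₁₂ x · P₁₂ v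
P₁₂-++ x v = begin
  P₁₂ (x ++ v)                           ≡⟨ foldl-++ (λ s x → insert₁₂ x s) (0 , 0 , 0) x v ⟩
  insertWord₁₂ (P₁₂ x) v                 ≡⟨ cong (λ q → insertWord₁₂ q v) (·-identityʳ (P₁₂ x)) ⟨
  insertWord₁₂ (P₁₂ x · (0 , 0 , 0)) v   ≡⟨ insertWord₁₂-· v (P₁₂ x) (0 , 0 , 0) ⟩
  P₁₂ x · P₁₂ v                          ∎
  where open ≡-Reasoning

newColumns : Plac₂ → Plac₂ → ℕ
newColumns (_ , b , _) (p′ , _ , _) = b ⊓ p′

·-comm⇒newColumns : ∀ s t → s · t ≡ t · s → newColumns s t ≡ newColumns t s
·-comm⇒newColumns (p , b , c) (p′ , b′ , c′) eq =
  +-cancelˡ-≡ (c + c′) _ _ (trans (cong (proj₂ ∘ proj₂) eq) (cong (_+ (b′ ⊓ p)) (+-comm c′ c)))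

newColumns⇒·-comm : ∀ s t → newColumns s t ≡ newColumns t s → s · t ≡ t · s
newColumns⇒·-comm (p , b , c) (p′ , b′ , c′) eq = cong₂ _,_ free₁ (cong₂ _,_ free₂ columns)
  where
  free₁ : p + (p′ ∸ (b ⊓ p′)) ≡ p′ + (p ∸ (b′ ⊓ p))
  free₁ = trans (sym (+-∸-assoc p (m⊓n≤n b p′)))
                (trans (cong₂ _∸_ (+-comm p p′) eq) (+-∸-assoc p′ (m⊓n≤n b′ p)))
  free₂ : (b ∸ (b ⊓ p′)) + b′ ≡ (b′ ∸ (b′ ⊓ p)) + b
  free₂ = trans (sym (+-∸-comm b′ (m⊓n≤m b p′)))
                (trans (cong₂ _∸_ (+-comm b b′) eq) (+-∸-comm b (m⊓n≤m b′ p)))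
  columns : c + c′ + (b ⊓ p′) ≡ c′ + c + (b′ ⊓ p)
  columns = cong₂ _+_ (+-comm c c′) eq

-- The powers of e keep its free 2s and collect free 1s, or the other way round.
Amplifies : Plac₂ → Plac₂ → Set
Amplifies (p , b , _) (p′ , b′ , _) = (b ≤ p × b′ ≡ b × p ≤ p′) ⊎ (p < b × p′ ≡ p × b ≤ b′)

Amplifies-refl : ∀ e → Amplifies e e
Amplifies-refl (p , b , c) with b ≤? p
... | yes b≤p = inj₁ (b≤p , refl , ≤-refl)
... | no  b≰p = inj₂ (≰⇒> b≰p , refl , ≤-refl)

Amplifies-· : ∀ e E → Amplifies e E → Amplifies e (e · E)
Amplifies-· (p , b , c) (pE , .b , cE) (inj₁ (b≤p , refl , p≤pE))
  rewrite m≤n⇒m⊓n≡m (≤-trans b≤p p≤pE) | n∸n≡0 b = inj₁ (b≤p , refl , m≤m+n p (pE ∸ b))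
Amplifies-· (p , b , c) (.p , bE , cE) (inj₂ (p<b , refl , b≤bE))
  rewrite m≥n⇒m⊓n≡n (<⇒≤ p<b) | n∸n≡0 p | +-identityʳ p =
  inj₂ (p<b , refl , ≤-trans b≤bE (m≤n+m bE (b ∸ p)))

Amplifies-^ : ∀ u k → Amplifies (P₁₂ u) (P₁₂ (u ^ʷ suc k))
Amplifies-^ u zero    rewrite ++-identityʳ u = Amplifies-refl (P₁₂ u)
Amplifies-^ u (suc k) rewrite P₁₂-++ u (u ^ʷ suc k) = Amplifies-· (P₁₂ u) (P₁₂ (u ^ʷ suc k)) (Amplifies-^ u k)

Amplifies-newColumns : ∀ e E t → Amplifies e E → newColumns E t ≡ newColumns t E → newColumns e t ≡ newColumns t e
Amplifies-newColumns (p , b , c) (pE , .b , cE) (pt , bt , ct) (inj₁ (b≤p , refl , p≤pE)) eq with bt ≤? p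
... | yes bt≤p rewrite m≤n⇒m⊓n≡m bt≤p | m≤n⇒m⊓n≡m (≤-trans bt≤p p≤pE) = eq
... | no  bt≰p with m≤n⇒m<n∨m≡n p≤pE
...   | inj₂ refl = eq
...   | inj₁ p<pE =
  ⊥-elim (<⇒≱ (⊓-glb (≰⇒> bt≰p) p<pE) (≤-trans (≤-reflexive (sym eq)) (≤-trans (m⊓n≤m b pt) b≤p)))
Amplifies-newColumns (p , b , c) (.p , bE , cE) (pt , bt , ct) (inj₂ (p<b , refl , b≤bE)) eq with pt ≤? b
... | yes pt≤b rewrite m≥n⇒m⊓n≡n pt≤b | m≥n⇒m⊓n≡n (≤-trans pt≤b b≤bE) = eq
... | no  pt≰b with m≤n⇒m<n∨m≡n b≤bE
...   | inj₂ refl = eq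
...   | inj₁ b<bE =
  ⊥-elim (<⇒≱ (<-trans (≤-<-trans (m⊓n≤n bt p) p<b) (⊓-glb b<bE (≰⇒> pt≰b))) (≤-reflexive eq))

·-comm-^ : ∀ u k t → P₁₂ (u ^ʷ suc k) · t ≡ t · P₁₂ (u ^ʷ suc k) → P₁₂ u · t ≡ t · P₁₂ u
·-comm-^ u k t eq =
  newColumns⇒·-comm (P₁₂ u) t
    (Amplifies-newColumns (P₁₂ u) (P₁₂ (u ^ʷ suc k)) t (Amplifies-^ u k) (·-comm⇒newColumns (P₁₂ (u ^ʷ suc k)) t eq))

-- Centralisers

^ʷ-suc : ∀ u k → u ^ʷ suc k ≡ u ^ʷ k ++ u
^ʷ-suc u zero    = ++-identityʳ u
^ʷ-suc u (suc k) = trans (cong (u ++_) (^ʷ-suc u k)) (sym (++-assoc u (u ^ʷ k) u))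

All-^ʷ : ∀ {Q : ℕ → Set} {u} k → All Q u → All Q (u ^ʷ k)
All-^ʷ zero    _  = []
All-^ʷ (suc k) qu = ++⁺ qu (All-^ʷ k qu)

P-++-⊑ : ∀ {v} x → All Small v → PositiveWord x → P (v ++ x) ⊑ P x
P-++-⊑ x []                  _  = ≼-refl
P-++-⊑ x (_∷_ {a} {v} sa sv) px =
  subst (_⊑ P x) (sym (P-∷ (v ++ x) sa (++⁺ (All-Small⇒PositiveWord sv) px)))
        (≼-trans (leftInsert-⊑ (P (v ++ x)) sa) (P-++-⊑ x sv px))

⊑-P-++ : ∀ {v} x → All Small v → PositiveWord x → P x ⊑ P (x ++ v)
⊑-P-++ x []                  _  rewrite ++-identityʳ x = ≼-refl
⊑-P-++ x (_∷_ {a} {v} sa sv) px =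
  ≼-trans (subst (P x ⊑_) (sym (P-++ x (a ∷ []))) (⊑-insertT sa (Admissible-P x px)))
          (subst (λ y → P (x ++ a ∷ []) ⊑ P y) (++-assoc x (a ∷ []) v)
                 (⊑-P-++ (x ++ a ∷ []) sv (++⁺ px (Small⇒1≤ sa ∷ []))))

largeRows-commute : ∀ {u w} k → All Small u → PositiveWord w → P (u ^ʷ suc k ++ w) ≡ P (w ++ u ^ʷ suc k) →
                    largeRows (split (P (u ++ w))) ≡ largeRows (split (P (w ++ u)))
largeRows-commute {u} {w} k su pw eq = trans (≼-antisym uw⊑w w⊑uw) (≼-antisym w⊑wu wu⊑w)
  where
  pu = All-Small⇒PositiveWord su
  uw⊑w : P (u ++ w) ⊑ P w
  uw⊑w = P-++-⊑ w su pw
  w⊑wu : P w ⊑ P (w ++ u)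
  w⊑wu = ⊑-P-++ w su pw
  uᵏ⁺¹w⊑uw : P (u ^ʷ suc k ++ w) ⊑ P (u ++ w)
  uᵏ⁺¹w⊑uw = subst (λ y → P y ⊑ P (u ++ w)) (trans (sym (++-assoc (u ^ʷ k) u w)) (cong (_++ w) (sym (^ʷ-suc u k))))
                   (P-++-⊑ (u ++ w) (All-^ʷ k su) (++⁺ pu pw))
  wu⊑wuᵏ⁺¹ : P (w ++ u) ⊑ P (w ++ u ^ʷ suc k)
  wu⊑wuᵏ⁺¹ = subst (λ y → P (w ++ u) ⊑ P y) (++-assoc w u (u ^ʷ k)) (⊑-P-++ (w ++ u) (All-^ʷ k su) (++⁺ pw pu))
  wuᵏ⁺¹⊑uw : P (w ++ u ^ʷ suc k) ⊑ P (u ++ w)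
  wuᵏ⁺¹⊑uw = subst (_⊑ P (u ++ w)) eq uᵏ⁺¹w⊑uw
  w⊑uw : P w ⊑ P (u ++ w)
  w⊑uw = ≼-trans w⊑wu (≼-trans wu⊑wuᵏ⁺¹ wuᵏ⁺¹⊑uw)
  wu⊑w : P (w ++ u) ⊑ P w
  wu⊑w = ≼-trans wu⊑wuᵏ⁺¹ (≼-trans wuᵏ⁺¹⊑uw uw⊑w)

P-≡⇒P₁₂-≡ : ∀ {x y} → PositiveWord x → PositiveWord y → P x ≡ P y → P₁₂ x ≡ P₁₂ y
P-≡⇒P₁₂-≡ {x} {y} px py eq =
  toCounts-injective (P₁₂ x) (P₁₂ y) (trans (sym (counts-P x px)) (trans (cong countsᵀ eq) (counts-P y py)))

counts-commute : ∀ {u w} k → All Small u → PositiveWord w → P (u ^ʷ suc k ++ w) ≡ P (w ++ u ^ʷ suc k) →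
                 countsᵀ (P (u ++ w)) ≡ countsᵀ (P (w ++ u))
counts-commute {u} {w} k su pw eq = begin
  countsᵀ (P (u ++ w))      ≡⟨ counts-P (u ++ w) (++⁺ pu pw) ⟩
  toCounts (P₁₂ (u ++ w))   ≡⟨ cong toCounts (P₁₂-++ u w) ⟩
  toCounts (P₁₂ u · P₁₂ w)  ≡⟨ cong toCounts (·-comm-^ u k (P₁₂ w) power-commutes) ⟩
  toCounts (P₁₂ w · P₁₂ u)  ≡⟨ cong toCounts (P₁₂-++ w u) ⟨
  toCounts (P₁₂ (w ++ u))   ≡⟨ counts-P (w ++ u) (++⁺ pw pu) ⟨
  countsᵀ (P (w ++ u))      ∎
  where
  open ≡-Reasoning
  pu = All-Small⇒PositiveWord su
  pu^ = All-^ʷ (suc k) pu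
  power-commutes : P₁₂ (u ^ʷ suc k) · P₁₂ w ≡ P₁₂ w · P₁₂ (u ^ʷ suc k)
  power-commutes = begin
    P₁₂ (u ^ʷ suc k) · P₁₂ w  ≡⟨ P₁₂-++ (u ^ʷ suc k) w ⟨
    P₁₂ (u ^ʷ suc k ++ w)     ≡⟨ P-≡⇒P₁₂-≡ (++⁺ pu^ pw) (++⁺ pw pu^) eq ⟩
    P₁₂ (w ++ u ^ʷ suc k)     ≡⟨ P₁₂-++ w (u ^ʷ suc k) ⟩
    P₁₂ w · P₁₂ (u ^ʷ suc k)  ∎

commute⇒commute-^ : ∀ {u w} → All Small u → PositiveWord w → P (u ++ w) ≡ P (w ++ u) →
                    ∀ k → P (u ^ʷ k ++ w) ≡ P (w ++ u ^ʷ k)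
commute⇒commute-^ {u} {w} su pw eq zero    = cong P (sym (++-identityʳ w))
commute⇒commute-^ {u} {w} su pw eq (suc k) = begin
  P ((u ++ u ^ʷ k) ++ w)   ≡⟨ cong P (++-assoc u (u ^ʷ k) w) ⟩
  P (u ++ u ^ʷ k ++ w)     ≡⟨ P-++-congˡ su (++⁺ pu^ pw) (++⁺ pw pu^) (commute⇒commute-^ su pw eq k) ⟩
  P (u ++ w ++ u ^ʷ k)     ≡⟨ cong P (++-assoc u w (u ^ʷ k)) ⟨
  P ((u ++ w) ++ u ^ʷ k)   ≡⟨ P-++-congʳ {u ++ w} {w ++ u} (u ^ʷ k) eq ⟩
  P ((w ++ u) ++ u ^ʷ k)   ≡⟨ cong P (++-assoc w u (u ^ʷ k)) ⟩
  P (w ++ u ++ u ^ʷ k)     ∎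
  where
  open ≡-Reasoning
  pu^ = All-^ʷ k (All-Small⇒PositiveWord su)

commute-^⇒commute : ∀ {u w} k → All Small u → PositiveWord w → P (u ^ʷ suc k ++ w) ≡ P (w ++ u ^ʷ suc k) →
                    P (u ++ w) ≡ P (w ++ u)
commute-^⇒commute k su pw eq =
  Admissible-≡ (Admissible-P _ (++⁺ pu pw)) (Admissible-P _ (++⁺ pw pu))
               (counts-commute k su pw eq) (largeRows-commute k su pw eq)
  where
  pu = All-Small⇒PositiveWord su

theorem2p13 : (n : ℕ) (u : Word) → length u ≡ n → All (λ x → x ≡ 1 ⊎ x ≡ 2) u →
    (k : ℕ) → 1 ≤ k → (w : Word) → C (u ^ʷ k) w ⇔ C u w
theorem2p13 _ u _ su (suc k) _ w =
  mk⇔ (λ (pw , eq) → pw , commute-^⇒commute k su pw eq)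
      (λ (pw , eq) → pw , commute⇒commute-^ su pw eq (suc k))
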